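{- Let $c_1>0$ be a constant and let $X_1,\dots,X_n$ be independent random variables with values in $\{1,\dots,n\}$ such that $\Pr(X_j=i)\ge c_1/n$ for all $i,j\in\{1,\dots,n\}$. For $i\in\{1,\dots,n\}$ let $\phi(i)=|\{j\in\{1,\dots,n\}: X_j=i\}|$, and let $G=\max\{\ell : \exists i\ \text{with}\ \phi(i)=\phi(i+1)=\dots=\phi(i+\ell)=0\}$ be the maximum gap size. Then there is a constant $c>0$ such that for all $\ell$, $\Pr(G\ge \ell)\le n2^{ -c\ell}$.
   Context: This describes job sizes in a random model of dynamic makespan scheduling where each job size performs a fair random walk on $\{1,\dots,n\}$ with reflecting barriers, after its mixing time has elapsed, so that each size takes each value with probability between $c_1/n$ and $c_2/n$ for constants $c_1,c_2>0$.
   Formalization: The constant $c_1$ and the probabilities $\Pr(X_j=i)$ take values in the rationals. -}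

module Defs where

open import Data.Bool using (Bool; true; false; if_then_else_)
open import Data.Nat as ℕ using (ℕ; zero; suc; _≡ᵇ_; _<ᵇ_; _⊔_)
open import Data.Fin as F using (Fin; toℕ)
open import Data.List as L using (List; []; _∷_; upTo; allFin; concatMap; foldr)
open import Data.Bool.ListAction using (and)
open import Data.Vec as V using (Vec; []; _∷_; countᵇ; lookup)
open import Data.Rational as ℚ using (ℚ; 0ℚ; 1ℚ; _+_; _*_)

_^ℚ_ : ℚ → ℕ → ℚ
p ^ℚ zero  = 1ℚ
p ^ℚ suc k = p * (p ^ℚ k)

open import Data.Integer using (+_)
ℕtoℚ : ℕ → ℚ
ℕtoℚ n = (+ n) ℚ./ 1

sumℚ : List ℚ → ℚ
sumℚ = foldr _+_ 0ℚ

-- All outcomes (X_1,…,X_k) with values in Fin n  (value v ∈ Fin n stands for v+1 ∈ {1..n}).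
outcomes : (n k : ℕ) → List (Vec (Fin n) k)
outcomes n zero    = [] ∷ []
outcomes n (suc k) = concatMap (λ v → L.map (v ∷_) (outcomes n k)) (allFin n)

-- A family of distributions: P j i = Pr(X_j = i).
Dist : ℕ → Set
Dist n = Fin n → Fin n → ℚ

-- Product weight (independence): Pr(X = x) = ∏_j P j (x_j).
weight : ∀ {n k} → (Fin k → Fin n → ℚ) → Vec (Fin n) k → ℚ
weight {k = zero}  P []       = 1ℚ
weight {k = suc k} P (v ∷ xs) = P F.zero v * weight (λ j → P (F.suc j)) xs

Pr : ∀ {n} → Dist n → (Vec (Fin n) n → Bool) → ℚ
Pr {n} P E = sumℚ (L.map (λ x → if E x then weight P x else 0ℚ) (outcomes n n))

-- φ(m) = |{ j : X_j = m }|  (bins indexed 0..n-1)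
φ : ∀ {n k} → Vec (Fin n) k → ℕ → ℕ
φ x m = countᵇ (λ v → toℕ v ≡ᵇ m) x

emptyRun : ∀ {n} → Vec (Fin n) n → ℕ → ℕ → Bool
emptyRun {n} x i ℓ = if (i ℕ.+ ℓ) <ᵇ n
                       then and (L.map (λ t → φ x (i ℕ.+ t) ≡ᵇ 0) (upTo (suc ℓ)))
                       else false

-- G = max { ℓ : ∃ i, φ(i) = … = φ(i+ℓ) = 0 }   (max ∅ = 0)
maxGap : ∀ {n} → Vec (Fin n) n → ℕ
maxGap {n} x = foldr _⊔_ 0
  (concatMap (λ i → L.map (λ ℓ → if emptyRun x i ℓ then ℓ else 0) (upTo n)) (upTo n))

module Submission where

open import Defs
open import Data.Nat using (ℕ; suc; _≤ᵇ_; _^_)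
open import Data.Fin using (Fin)
open import Data.List using (map; allFin)
open import Data.Product using (Σ; _×_)
open import Data.Rational using (ℚ; 0ℚ; 1ℚ; _<_; _≤_; _*_)
open import Relation.Binary.PropositionalEquality using (_≡_)

-- Put d = c₁/N, so that every probability P j v is at least d.  If the
-- maximum gap is at least ℓ, then some window [i, i+ℓ) of ℓ consecutive bins
-- with i+ℓ ≤ N receives no ball.  By independence, the probability that a
-- fixed window stays empty is the product over the balls j of the mass S_j
-- that P j puts outside the window, and S_j ≤ 1 - ℓd ≤ (1-d)^ℓ by Bernoulli's
-- inequality.  A union bound over the N window positions gives
--     Pr(G ≥ ℓ) ≤ N · ((1-d)^ℓ)^N                               (gap-tail-bound).
-- Let D be the denominator of c₁, so that D·c₁ ≥ 1, and K = N·D, so that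
-- K·d ≥ 1.  Then (1-d)^K · 2 ≤ 1 (halving), and raising the union bound to
-- the power D gives Pr(G ≥ ℓ)^D · 2^ℓ ≤ N^D (trade-power-for-decay), that is
-- Pr(G ≥ ℓ) ≤ N · 2^(-ℓ/D): the theorem with q = D - 1.

open import Data.Bool using (Bool; true; false; T; if_then_else_; _∧_)
open import Data.Bool.Properties using (T-∧; T-≡)
open import Data.Empty using (⊥; ⊥-elim)
open import Data.Unit using (tt)
open import Data.Fin as Fin using (toℕ)
import Data.Integer as ℤ
import Data.Integer.Properties as ℤP
open import Data.List using (List; []; _∷_; _++_; concatMap; upTo; tabulate; length; foldr)
open import Data.Bool.ListAction using (and)
open import Data.List.Membership.Propositional using (_∈_; find)
open import Data.List.Membership.Propositional.Properties using (∈-map⁻; ∈-concatMap⁻; ∈-upTo⁺)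
import Data.List.Properties as ListP
open import Data.List.Relation.Unary.Any using (here; there)
import Data.Nat as ℕ
open import Data.Nat.Coprimality using (Coprime; 1-coprimeTo) renaming (sym to coprime-sym)
import Data.Nat.Properties as ℕP
open import Data.Product using (_,_; proj₁; proj₂)
open import Data.Rational using (mkℚ; _+_; _-_; -_; 1/_; *<*)
import Data.Rational as ℚ
import Data.Rational.Properties as QP
import Data.Rational.Unnormalised as ℚᵘ
import Data.Rational.Unnormalised.Properties as ℚᵘP
open import Data.Sum using (inj₁; inj₂)
open import Data.Vec using (Vec; countᵇ) renaming ([] to []ᵥ; _∷_ to _∷ᵥ_)
open import Function using (Equivalence)
open import Relation.Binary.PropositionalEquality
  using (refl; sym; trans; cong; cong₂; subst)
open import Relation.Nullary.Decidable using (dec⇒maybe)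
open import Tactic.RingSolver using (solve-∀)
import Tactic.RingSolver.Core.AlmostCommutativeRing as ACR
open import Algebra.Bundles using (CommutativeRing)
open import Algebra.Properties.CommutativeMonoid.Sum QP.+-0-commutativeMonoid
  using (sum; sum-cong-≗; ∑-distrib-+)
open import Algebra.Properties.CommutativeSemiring.Exp (CommutativeRing.commutativeSemiring QP.+-*-commutativeRing)
  using (^-assocʳ; ^-distrib-*) renaming (_^_ to _^ᴿ_)
open import Algebra.Definitions.RawSemiring ℚ.+-*-rawSemiring using (product)
open import Algebra.Properties.Semiring.Mult (CommutativeRing.semiring QP.+-*-commutativeRing)
  using (×1-homo-*) renaming (_×_ to _times_)

ℚ-ring : ACR.AlmostCommutativeRing _ _
ℚ-ring = ACR.fromCommutativeRing QP.+-*-commutativeRing (λ p → dec⇒maybe (0ℚ QP.≟ p))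

open QP.≤-Reasoning

-- Order facts on ℚ.  The library states sign-preservation with instance
-- predicates; these wrappers state them with explicit inequalities.

0≤1 : 0ℚ ≤ 1ℚ
0≤1 = QP.nonNegative⁻¹ 1ℚ

*-nonNeg : ∀ {p q} → 0ℚ ≤ p → 0ℚ ≤ q → 0ℚ ≤ p * q
*-nonNeg {p} {q} 0≤p 0≤q = QP.nonNegative⁻¹ (p * q)
  {{QP.nonNeg*nonNeg⇒nonNeg p {{ℚ.nonNegative 0≤p}} q {{ℚ.nonNegative 0≤q}}}}

+-nonNeg : ∀ {p q} → 0ℚ ≤ p → 0ℚ ≤ q → 0ℚ ≤ p + q
+-nonNeg = QP.+-mono-≤

-- Squares are nonnegative (needed for Bernoulli's inequality with x < 0).
square-nonNeg : ∀ x → 0ℚ ≤ x * x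
square-nonNeg x with QP.≤-total 0ℚ x
... | inj₁ 0≤x = *-nonNeg 0≤x 0≤x
... | inj₂ x≤0 = QP.nonNegative⁻¹ (x * x)
  {{QP.nonPos*nonPos⇒nonPos x {{ℚ.nonPositive x≤0}} x {{ℚ.nonPositive x≤0}}}}

*-monoˡ-≤ : ∀ r {p q} → 0ℚ ≤ r → p ≤ q → r * p ≤ r * q
*-monoˡ-≤ r 0≤r = QP.*-monoˡ-≤-nonNeg r {{ℚ.nonNegative 0≤r}}

*-mono-≤ : ∀ {p q r s} → 0ℚ ≤ p → 0ℚ ≤ r → p ≤ q → r ≤ s → p * r ≤ q * s
*-mono-≤ {p} {q} {r} {s} 0≤p 0≤r p≤q r≤s = begin
  p * r ≤⟨ QP.*-monoʳ-≤-nonNeg r {{ℚ.nonNegative 0≤r}} p≤q ⟩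
  q * r ≤⟨ *-monoˡ-≤ q (QP.≤-trans 0≤p p≤q) r≤s ⟩
  q * s ∎

p≤p+q : ∀ {p q} → 0ℚ ≤ q → p ≤ p + q
p≤p+q {p} {q} 0≤q = begin
  p      ≡⟨ sym (QP.+-identityʳ p) ⟩
  p + 0ℚ ≤⟨ QP.+-monoʳ-≤ p 0≤q ⟩
  p + q  ∎

p≤q+p : ∀ {p q} → 0ℚ ≤ q → p ≤ q + p
p≤q+p {p} {q} 0≤q = QP.≤-trans (p≤p+q 0≤q) (QP.≤-reflexive (QP.+-comm p q))

0≤q-p : ∀ {p q} → p ≤ q → 0ℚ ≤ q - p
0≤q-p {p} {q} p≤q = begin
  0ℚ     ≡⟨ sym (QP.+-inverseʳ p) ⟩
  p - p  ≤⟨ QP.+-monoˡ-≤ (- p) p≤q ⟩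
  q - p  ∎

ℕtoℚ-normal : ∀ m → ℕtoℚ m ≡ mkℚ (ℤ.+ m) 0 (coprime-sym (1-coprimeTo m))
ℕtoℚ-normal m = QP.normalize-coprime (coprime-sym (1-coprimeTo m))

ℕtoℚ-suc : ∀ m → ℕtoℚ (suc m) ≡ 1ℚ + ℕtoℚ m
ℕtoℚ-suc m rewrite ℕtoℚ-normal m = QP./-cong {ℤ.+ suc m} numerators refl
  where
  numerators : ℤ.+ suc m ≡ ℤ.+ 1 ℤ.* ℤ.+ 1 ℤ.+ ℤ.+ m ℤ.* ℤ.+ 1
  numerators = cong (λ z → ℤ.+ 1 ℤ.+ z) (sym (ℤP.*-identityʳ (ℤ.+ m)))

-- ℕtoℚ m is the m-fold sum of 1ℚ, which lets us reuse the library's laws.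
ℕtoℚ≡times : ∀ m → ℕtoℚ m ≡ m times 1ℚ
ℕtoℚ≡times ℕ.zero    = refl
ℕtoℚ≡times (suc m) = trans (ℕtoℚ-suc m) (cong (1ℚ +_) (ℕtoℚ≡times m))

ℕtoℚ-* : ∀ a b → ℕtoℚ (a ℕ.* b) ≡ ℕtoℚ a * ℕtoℚ b
ℕtoℚ-* a b = begin-equality
  ℕtoℚ (a ℕ.* b)                  ≡⟨ ℕtoℚ≡times (a ℕ.* b) ⟩
  (a ℕ.* b) times 1ℚ              ≡⟨ ×1-homo-* a b ⟩
  (a times 1ℚ) * (b times 1ℚ)     ≡⟨ sym (cong₂ _*_ (ℕtoℚ≡times a) (ℕtoℚ≡times b)) ⟩
  ℕtoℚ a * ℕtoℚ b                 ∎

ℕtoℚ-nonNeg : ∀ m → 0ℚ ≤ ℕtoℚ m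
ℕtoℚ-nonNeg m = QP.nonNegative⁻¹ (ℕtoℚ m) {{QP.normalize-nonNeg m 1}}

1≤ℕtoℚ-suc : ∀ m → 1ℚ ≤ ℕtoℚ (suc m)
1≤ℕtoℚ-suc m = QP.≤-trans (p≤p+q (ℕtoℚ-nonNeg m)) (QP.≤-reflexive (sym (ℕtoℚ-suc m)))

-- Powers.  The power _^ℚ_ of Defs agrees with the library's semiring power,
-- whose algebraic laws we transport.

^ℚ≡^ᴿ : ∀ x k → x ^ℚ k ≡ x ^ᴿ k
^ℚ≡^ᴿ x ℕ.zero    = refl
^ℚ≡^ᴿ x (suc k) = cong (x *_) (^ℚ≡^ᴿ x k)

^ℚ-assoc : ∀ x m k → (x ^ℚ m) ^ℚ k ≡ x ^ℚ (m ℕ.* k)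
^ℚ-assoc x m k = begin-equality
  (x ^ℚ m) ^ℚ k    ≡⟨ ^ℚ≡^ᴿ (x ^ℚ m) k ⟩
  (x ^ℚ m) ^ᴿ k    ≡⟨ cong (_^ᴿ k) (^ℚ≡^ᴿ x m) ⟩
  (x ^ᴿ m) ^ᴿ k    ≡⟨ ^-assocʳ x m k ⟩
  x ^ᴿ (m ℕ.* k)   ≡⟨ sym (^ℚ≡^ᴿ x (m ℕ.* k)) ⟩
  x ^ℚ (m ℕ.* k)   ∎

^ℚ-distrib-* : ∀ x y k → (x * y) ^ℚ k ≡ (x ^ℚ k) * (y ^ℚ k)
^ℚ-distrib-* x y k = begin-equality
  (x * y) ^ℚ k         ≡⟨ ^ℚ≡^ᴿ (x * y) k ⟩
  (x * y) ^ᴿ k         ≡⟨ ^-distrib-* x y k ⟩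
  (x ^ᴿ k) * (y ^ᴿ k)  ≡⟨ sym (cong₂ _*_ (^ℚ≡^ᴿ x k) (^ℚ≡^ᴿ y k)) ⟩
  (x ^ℚ k) * (y ^ℚ k)  ∎

ℕtoℚ-^ : ∀ a k → ℕtoℚ (a ^ k) ≡ ℕtoℚ a ^ℚ k
ℕtoℚ-^ a ℕ.zero    = refl
ℕtoℚ-^ a (suc k) = trans (ℕtoℚ-* a (a ^ k)) (cong (ℕtoℚ a *_) (ℕtoℚ-^ a k))

^ℚ-nonNeg : ∀ {x} k → 0ℚ ≤ x → 0ℚ ≤ x ^ℚ k
^ℚ-nonNeg ℕ.zero    _   = 0≤1
^ℚ-nonNeg (suc k) 0≤x = *-nonNeg 0≤x (^ℚ-nonNeg k 0≤x)

^ℚ-mono-≤ : ∀ {x y} k → 0ℚ ≤ x → x ≤ y → x ^ℚ k ≤ y ^ℚ k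
^ℚ-mono-≤ ℕ.zero    _   _   = QP.≤-refl
^ℚ-mono-≤ (suc k) 0≤x x≤y = *-mono-≤ 0≤x (^ℚ-nonNeg k 0≤x) x≤y (^ℚ-mono-≤ k 0≤x x≤y)

^ℚ-≤1 : ∀ {x} k → 0ℚ ≤ x → x ≤ 1ℚ → x ^ℚ k ≤ 1ℚ
^ℚ-≤1 ℕ.zero    _   _   = QP.≤-refl
^ℚ-≤1 (suc k) 0≤x x≤1 = *-mono-≤ 0≤x (^ℚ-nonNeg k 0≤x) x≤1 (^ℚ-≤1 k 0≤x x≤1)

bernoulli : ∀ {x} → 0ℚ ≤ 1ℚ + x → ∀ k → 1ℚ + ℕtoℚ k * x ≤ (1ℚ + x) ^ℚ k
bernoulli {x} _ ℕ.zero = QP.≤-reflexive (trans (cong (1ℚ +_) (QP.*-zeroˡ x)) (QP.+-identityʳ 1ℚ))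
bernoulli {x} 0≤1+x (suc k) = begin
  1ℚ + ℕtoℚ (suc k) * x                   ≡⟨ cong (λ t → 1ℚ + t * x) (ℕtoℚ-suc k) ⟩
  1ℚ + (1ℚ + ℕtoℚ k) * x                  ≤⟨ p≤p+q (*-nonNeg (ℕtoℚ-nonNeg k) (square-nonNeg x)) ⟩
  1ℚ + (1ℚ + ℕtoℚ k) * x + ℕtoℚ k * (x * x) ≡⟨ expand (ℕtoℚ k) x ⟩
  (1ℚ + x) * (1ℚ + ℕtoℚ k * x)            ≤⟨ *-monoˡ-≤ (1ℚ + x) 0≤1+x (bernoulli 0≤1+x k) ⟩
  (1ℚ + x) * (1ℚ + x) ^ℚ k                ∎
  where
  expand : ∀ k x → 1ℚ + (1ℚ + k) * x + k * (x * x) ≡ (1ℚ + x) * (1ℚ + k * x)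
  expand = solve-∀ ℚ-ring

-- If K·d ≥ 1 with 0 ≤ d ≤ 1 then (1-d)^K ≤ 1/2: indeed (1-d)^K (1+d)^K ≤ 1
-- while (1+d)^K ≥ 1 + K·d ≥ 2.
halving : ∀ {d} → 0ℚ ≤ d → d ≤ 1ℚ → ∀ K → 1ℚ ≤ ℕtoℚ K * d →
          ((1ℚ - d) ^ℚ K) * ℕtoℚ 2 ≤ 1ℚ
halving {d} 0≤d d≤1 K 1≤Kd = begin
  z * ℕtoℚ 2                ≡⟨ cong (z *_) (ℕtoℚ-suc 1) ⟩
  z * (1ℚ + 1ℚ)             ≤⟨ *-monoˡ-≤ z 0≤z (QP.+-monoʳ-≤ 1ℚ 1≤Kd) ⟩
  z * (1ℚ + ℕtoℚ K * d)     ≤⟨ *-monoˡ-≤ z 0≤z (bernoulli (+-nonNeg 0≤1 0≤d) K) ⟩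
  z * (1ℚ + d) ^ℚ K         ≡⟨ sym (^ℚ-distrib-* (1ℚ - d) (1ℚ + d) K) ⟩
  ((1ℚ - d) * (1ℚ + d)) ^ℚ K ≤⟨ ^ℚ-≤1 K (*-nonNeg (0≤q-p d≤1) (+-nonNeg 0≤1 0≤d)) product≤1 ⟩
  1ℚ                        ∎
  where
  z : ℚ
  z = (1ℚ - d) ^ℚ K
  0≤z : 0ℚ ≤ z
  0≤z = ^ℚ-nonNeg K (0≤q-p d≤1)
  difference-of-squares : ∀ d → (1ℚ - d) * (1ℚ + d) ≡ 1ℚ - d * d
  difference-of-squares = solve-∀ ℚ-ring
  product≤1 : (1ℚ - d) * (1ℚ + d) ≤ 1ℚ
  product≤1 = begin
    (1ℚ - d) * (1ℚ + d) ≡⟨ difference-of-squares d ⟩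
    1ℚ - d * d          ≤⟨ QP.+-monoʳ-≤ 1ℚ (QP.neg-antimono-≤ (square-nonNeg d)) ⟩
    1ℚ - 0ℚ             ≡⟨ QP.+-identityʳ 1ℚ ⟩
    1ℚ                  ∎

sum-nonNeg : ∀ {N} {f : Fin N → ℚ} → (∀ v → 0ℚ ≤ f v) → 0ℚ ≤ sum f
sum-nonNeg {ℕ.zero}  _     = QP.≤-refl
sum-nonNeg {suc N} 0≤f = +-nonNeg (0≤f Fin.zero) (sum-nonNeg (λ v → 0≤f (Fin.suc v)))

sumℚ-tabulate : ∀ N (f : Fin N → ℚ) → sumℚ (tabulate f) ≡ sum f
sumℚ-tabulate ℕ.zero    f = refl
sumℚ-tabulate (suc N) f = cong (f Fin.zero +_) (sumℚ-tabulate N (λ v → f (Fin.suc v)))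

sumℚ-allFin : ∀ N (f : Fin N → ℚ) → sumℚ (map f (allFin N)) ≡ sum f
sumℚ-allFin N f = trans (cong sumℚ (ListP.map-tabulate (λ v → v) f)) (sumℚ-tabulate N f)

if-nonNeg : ∀ b {x} → 0ℚ ≤ x → 0ℚ ≤ (if b then x else 0ℚ)
if-nonNeg true  0≤x = 0≤x
if-nonNeg false _   = QP.≤-refl

window-mass : ∀ {d} → 0ℚ ≤ d → ∀ {N} (f : Fin N → ℚ) → (∀ v → d ≤ f v) →
              (p : ℕ → Bool) (i ℓ : ℕ) → i ℕ.+ ℓ ℕ.≤ N →
              (∀ k → i ℕ.≤ k → k ℕ.< i ℕ.+ ℓ → T (p k)) →
              ℕtoℚ ℓ * d ≤ sum (λ v → if p (toℕ v) then f v else 0ℚ)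
window-mass {d} _ {ℕ.zero} f _ p ℕ.zero ℕ.zero _ _ = QP.≤-reflexive (QP.*-zeroˡ d)
window-mass 0≤d {suc N} f d≤f p (suc i) ℓ (ℕ.s≤s i+ℓ≤N) p-on-window =
  QP.≤-trans (window-mass 0≤d (λ v → f (Fin.suc v)) (λ v → d≤f (Fin.suc v)) (λ k → p (suc k))
                           i ℓ i+ℓ≤N (λ k i≤k k<i+ℓ → p-on-window (suc k) (ℕ.s≤s i≤k) (ℕ.s≤s k<i+ℓ)))
             (p≤q+p (if-nonNeg (p 0) (QP.≤-trans 0≤d (d≤f Fin.zero))))
window-mass {d} 0≤d {suc N} f d≤f p ℕ.zero ℕ.zero _ _ =
  QP.≤-trans (QP.≤-reflexive (QP.*-zeroˡ d))
             (sum-nonNeg (λ v → if-nonNeg (p (toℕ v)) (QP.≤-trans 0≤d (d≤f v))))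
window-mass {d} 0≤d {suc N} f d≤f p ℕ.zero (suc ℓ) (ℕ.s≤s ℓ≤N) p-on-window
  with p 0 | p-on-window 0 ℕ.z≤n (ℕ.s≤s ℕ.z≤n)
... | true | _ = begin
  ℕtoℚ (suc ℓ) * d      ≡⟨ cong (_* d) (ℕtoℚ-suc ℓ) ⟩
  (1ℚ + ℕtoℚ ℓ) * d     ≡⟨ QP.*-distribʳ-+ d 1ℚ (ℕtoℚ ℓ) ⟩
  1ℚ * d + ℕtoℚ ℓ * d   ≡⟨ cong (_+ ℕtoℚ ℓ * d) (QP.*-identityˡ d) ⟩
  d + ℕtoℚ ℓ * d        ≤⟨ QP.+-mono-≤ (d≤f Fin.zero) rest ⟩
  f Fin.zero + sum (λ v → if p (suc (toℕ v)) then f (Fin.suc v) else 0ℚ) ∎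
  where
  rest : ℕtoℚ ℓ * d ≤ sum (λ v → if p (suc (toℕ v)) then f (Fin.suc v) else 0ℚ)
  rest = window-mass 0≤d (λ v → f (Fin.suc v)) (λ v → d≤f (Fin.suc v)) (λ k → p (suc k)) 0 ℓ ℓ≤N
           (λ k _ k<ℓ → p-on-window (suc k) ℕ.z≤n (ℕ.s≤s k<ℓ))

module _ {A : Set} where

  sumOver : (A → ℚ) → List A → ℚ
  sumOver f xs = sumℚ (map f xs)

  sumOver-++ : ∀ (f : A → ℚ) xs ys → sumOver f (xs ++ ys) ≡ sumOver f xs + sumOver f ys
  sumOver-++ f []       ys = sym (QP.+-identityˡ _)
  sumOver-++ f (x ∷ xs) ys = trans (cong (f x +_) (sumOver-++ f xs ys)) (sym (QP.+-assoc (f x) _ _))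

  sumOver-cong : ∀ {f g : A → ℚ} xs → (∀ x → f x ≡ g x) → sumOver f xs ≡ sumOver g xs
  sumOver-cong []       _   = refl
  sumOver-cong (x ∷ xs) f≡g = cong₂ _+_ (f≡g x) (sumOver-cong xs f≡g)

  sumOver-nonNeg : ∀ {f : A → ℚ} xs → (∀ x → 0ℚ ≤ f x) → 0ℚ ≤ sumOver f xs
  sumOver-nonNeg []       _   = QP.≤-refl
  sumOver-nonNeg (x ∷ xs) 0≤f = +-nonNeg (0≤f x) (sumOver-nonNeg xs 0≤f)

  sumOver-mono : ∀ {f g : A → ℚ} xs → (∀ x → f x ≤ g x) → sumOver f xs ≤ sumOver g xs
  sumOver-mono []       _   = QP.≤-refl
  sumOver-mono (x ∷ xs) f≤g = QP.+-mono-≤ (f≤g x) (sumOver-mono xs f≤g)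

  sumOver-*ˡ : ∀ c (f : A → ℚ) xs → sumOver (λ x → c * f x) xs ≡ c * sumOver f xs
  sumOver-*ˡ c f []       = sym (QP.*-zeroʳ c)
  sumOver-*ˡ c f (x ∷ xs) =
    trans (cong (c * f x +_) (sumOver-*ˡ c f xs)) (sym (QP.*-distribˡ-+ c (f x) _))

  sumOver-*ʳ : ∀ c (f : A → ℚ) xs → sumOver (λ x → f x * c) xs ≡ sumOver f xs * c
  sumOver-*ʳ c f []       = sym (QP.*-zeroˡ c)
  sumOver-*ʳ c f (x ∷ xs) =
    trans (cong (f x * c +_) (sumOver-*ʳ c f xs)) (sym (QP.*-distribʳ-+ c (f x) _))

  sumOver-zero : ∀ xs → sumOver (λ _ → 0ℚ) xs ≡ 0ℚ
  sumOver-zero []       = refl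
  sumOver-zero (x ∷ xs) = trans (cong (0ℚ +_) (sumOver-zero xs)) (QP.+-identityˡ 0ℚ)

  sumOver-+ : ∀ (f g : A → ℚ) xs → sumOver (λ x → f x + g x) xs ≡ sumOver f xs + sumOver g xs
  sumOver-+ f g []       = refl
  sumOver-+ f g (x ∷ xs) =
    trans (cong (f x + g x +_) (sumOver-+ f g xs)) (interchange (f x) (g x) _ _)
    where
    interchange : ∀ a b c d → (a + b) + (c + d) ≡ (a + c) + (b + d)
    interchange = solve-∀ ℚ-ring

  sumOver-member : ∀ {f : A → ℚ} {y} xs → (∀ x → 0ℚ ≤ f x) → y ∈ xs → f y ≤ sumOver f xs
  sumOver-member (x ∷ xs) 0≤f (here refl) = p≤p+q (sumOver-nonNeg xs 0≤f)
  sumOver-member (x ∷ xs) 0≤f (there y∈xs) = QP.≤-trans (sumOver-member xs 0≤f y∈xs) (p≤q+p (0≤f x))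

  sumOver-≤-length : ∀ {f : A → ℚ} {b} xs → (∀ x → f x ≤ b) →
                     sumOver f xs ≤ ℕtoℚ (length xs) * b
  sumOver-≤-length {b = b} []       _   = QP.≤-reflexive (sym (QP.*-zeroˡ b))
  sumOver-≤-length {b = b} (x ∷ xs) f≤b = begin
    _                                  ≤⟨ QP.+-mono-≤ (f≤b x) (sumOver-≤-length xs f≤b) ⟩
    b + ℕtoℚ (length xs) * b      ≡⟨ cong (_+ ℕtoℚ (length xs) * b) (sym (QP.*-identityˡ b)) ⟩
    1ℚ * b + ℕtoℚ (length xs) * b ≡⟨ sym (QP.*-distribʳ-+ b 1ℚ (ℕtoℚ (length xs))) ⟩
    (1ℚ + ℕtoℚ (length xs)) * b   ≡⟨ cong (_* b) (sym (ℕtoℚ-suc (length xs))) ⟩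
    ℕtoℚ (length (x ∷ xs)) * b    ∎

sumOver-map : ∀ {A B : Set} (f : B → ℚ) (g : A → B) xs →
              sumOver f (map g xs) ≡ sumOver (λ x → f (g x)) xs
sumOver-map f g []       = refl
sumOver-map f g (x ∷ xs) = cong (f (g x) +_) (sumOver-map f g xs)

sumOver-concatMap : ∀ {A B : Set} (f : B → ℚ) (G : A → List B) xs →
                    sumOver f (concatMap G xs) ≡ sumOver (λ v → sumOver f (G v)) xs
sumOver-concatMap f G []       = refl
sumOver-concatMap f G (x ∷ xs) =
  trans (sumOver-++ f (G x) (concatMap G xs)) (cong (sumOver f (G x) +_) (sumOver-concatMap f G xs))

sumOver-swap : ∀ {A B : Set} (F : B → A → ℚ) xs is →
  sumOver (λ x → sumOver (λ i → F i x) is) xs ≡ sumOver (λ i → sumOver (F i) xs) is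
sumOver-swap F []       is = sym (sumOver-zero is)
sumOver-swap F (x ∷ xs) is =
  trans (cong (sumOver (λ i → F i x) is +_) (sumOver-swap F xs is))
        (sym (sumOver-+ (λ i → F i x) (λ i → sumOver (F i) xs) is))

productOver : ∀ {n k} → (Fin n → ℚ) → Vec (Fin n) k → ℚ
productOver g []ᵥ       = 1ℚ
productOver g (v ∷ᵥ xs) = g v * productOver g xs

independence : ∀ {n} k (Q : Fin k → Fin n → ℚ) (g : Fin n → ℚ) →
  sumOver (λ x → weight Q x * productOver g x) (outcomes n k)
    ≡ product (λ j → sum (λ v → Q j v * g v))
independence ℕ.zero Q g = refl
independence {n} (suc k) Q g = begin-equality
  sumOver F (outcomes n (suc k))
    ≡⟨ sumOver-concatMap F (λ v → map (v ∷ᵥ_) (outcomes n k)) (allFin n) ⟩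
  sumOver (λ v → sumOver F (map (v ∷ᵥ_) (outcomes n k))) (allFin n)
    ≡⟨ sumOver-cong (allFin n) first-coordinate ⟩
  sumOver (λ v → (Q Fin.zero v * g v) * R) (allFin n)
    ≡⟨ sumOver-*ʳ R (λ v → Q Fin.zero v * g v) (allFin n) ⟩
  sumOver (λ v → Q Fin.zero v * g v) (allFin n) * R
    ≡⟨ cong (_* R) (sumℚ-allFin n (λ v → Q Fin.zero v * g v)) ⟩
  sum (λ v → Q Fin.zero v * g v) * R ∎
  where
  F : Vec (Fin n) (suc k) → ℚ
  F x = weight Q x * productOver g x
  Q′ : Fin k → Fin n → ℚ
  Q′ j = Q (Fin.suc j)
  R : ℚ
  R = product (λ j → sum (λ v → Q′ j v * g v))
  regroup : ∀ a b c d → (a * b) * (c * d) ≡ (a * c) * (b * d)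
  regroup = solve-∀ ℚ-ring
  first-coordinate : ∀ v → sumOver F (map (v ∷ᵥ_) (outcomes n k)) ≡ (Q Fin.zero v * g v) * R
  first-coordinate v = begin-equality
    sumOver F (map (v ∷ᵥ_) (outcomes n k))
      ≡⟨ sumOver-map F (v ∷ᵥ_) (outcomes n k) ⟩
    sumOver (λ xs → (Q Fin.zero v * weight Q′ xs) * (g v * productOver g xs)) (outcomes n k)
      ≡⟨ sumOver-cong (outcomes n k) (λ xs → regroup (Q Fin.zero v) (weight Q′ xs) (g v) (productOver g xs)) ⟩
    sumOver (λ xs → (Q Fin.zero v * g v) * (weight Q′ xs * productOver g xs)) (outcomes n k)
      ≡⟨ sumOver-*ˡ (Q Fin.zero v * g v) (λ xs → weight Q′ xs * productOver g xs) (outcomes n k) ⟩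
    (Q Fin.zero v * g v) * sumOver (λ xs → weight Q′ xs * productOver g xs) (outcomes n k)
      ≡⟨ cong ((Q Fin.zero v * g v) *_) (independence k Q′ g) ⟩
    (Q Fin.zero v * g v) * R ∎

weight-nonNeg : ∀ {n k} (Q : Fin k → Fin n → ℚ) → (∀ j v → 0ℚ ≤ Q j v) →
                (x : Vec (Fin n) k) → 0ℚ ≤ weight Q x
weight-nonNeg Q 0≤Q []ᵥ       = 0≤1
weight-nonNeg Q 0≤Q (v ∷ᵥ xs) =
  *-nonNeg (0≤Q Fin.zero v) (weight-nonNeg (λ j → Q (Fin.suc j)) (λ j → 0≤Q (Fin.suc j)) xs)

product-≤-^ : ∀ k {F : Fin k → ℚ} {b} → (∀ j → 0ℚ ≤ F j) → (∀ j → F j ≤ b) → product F ≤ b ^ℚ k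
product-≤-^ ℕ.zero    _   _   = QP.≤-refl
product-≤-^ (suc k) 0≤F F≤b =
  *-mono-≤ (0≤F Fin.zero) (product-nonNeg k (λ j → 0≤F (Fin.suc j))) (F≤b Fin.zero)
           (product-≤-^ k (λ j → 0≤F (Fin.suc j)) (λ j → F≤b (Fin.suc j)))
  where
  product-nonNeg : ∀ k {F : Fin k → ℚ} → (∀ j → 0ℚ ≤ F j) → 0ℚ ≤ product F
  product-nonNeg ℕ.zero    _   = 0≤1
  product-nonNeg (suc k) 0≤F = *-nonNeg (0≤F Fin.zero) (product-nonNeg k (λ j → 0≤F (Fin.suc j)))

inWindow : ℕ → ℕ → ℕ → Bool
inWindow i ℓ k = (k ℕ.<ᵇ i ℕ.+ ℓ) ∧ (i ℕ.≤ᵇ k)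

outside : ∀ {N} → ℕ → ℕ → Fin N → ℚ
outside i ℓ v = if inWindow i ℓ (toℕ v) then 0ℚ else 1ℚ

outside-nonNeg : ∀ {N} i ℓ (v : Fin N) → 0ℚ ≤ outside i ℓ v
outside-nonNeg i ℓ v with inWindow i ℓ (toℕ v)
... | true  = QP.≤-refl
... | false = 0≤1

WindowEmpty : ∀ {N k} → Vec (Fin N) k → ℕ → ℕ → Set
WindowEmpty x i ℓ = ∀ m → i ℕ.≤ m → m ℕ.< i ℕ.+ ℓ → φ x m ≡ 0

countᵇ-∷-zero : ∀ {A : Set} {k} (p : A → Bool) v (xs : Vec A k) →
                countᵇ p (v ∷ᵥ xs) ≡ 0 → (T (p v) → ⊥) × (countᵇ p xs ≡ 0)
countᵇ-∷-zero p v xs count≡0 with p v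
... | false = (λ ()) , count≡0

emptyWindow⇒outside : ∀ {N k} i ℓ (x : Vec (Fin N) k) → WindowEmpty x i ℓ →
                      productOver (outside i ℓ) x ≡ 1ℚ
emptyWindow⇒outside i ℓ []ᵥ       _     = refl
emptyWindow⇒outside i ℓ (v ∷ᵥ xs) empty =
  trans (cong₂ _*_ head-outside (emptyWindow⇒outside i ℓ xs tail-empty)) (QP.*-identityʳ 1ℚ)
  where
  tail-empty : WindowEmpty xs i ℓ
  tail-empty m i≤m m<i+ℓ = proj₂ (countᵇ-∷-zero (λ w → toℕ w ℕ.≡ᵇ m) v xs (empty m i≤m m<i+ℓ))
  head-outside : outside i ℓ v ≡ 1ℚ
  head-outside with inWindow i ℓ (toℕ v) in inside
  ... | false = refl
  ... | true  = ⊥-elim (proj₁ (countᵇ-∷-zero (λ w → toℕ w ℕ.≡ᵇ toℕ v) v xs (empty (toℕ v) i≤v v<i+ℓ))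
                               (ℕP.≡⇒≡ᵇ (toℕ v) (toℕ v) refl))
    where
    bounds : T (toℕ v ℕ.<ᵇ i ℕ.+ ℓ) × T (i ℕ.≤ᵇ toℕ v)
    bounds = Equivalence.to T-∧ (subst T (sym inside) tt)
    i≤v : i ℕ.≤ toℕ v
    i≤v = ℕP.≤ᵇ⇒≤ i (toℕ v) (proj₂ bounds)
    v<i+ℓ : toℕ v ℕ.< i ℕ.+ ℓ
    v<i+ℓ = ℕP.<ᵇ⇒< (toℕ v) (i ℕ.+ ℓ) (proj₁ bounds)

⊔-witness : ∀ {s} ys → suc s ℕ.≤ foldr ℕ._⊔_ 0 ys → Σ ℕ λ y → y ∈ ys × suc s ℕ.≤ y
⊔-witness (y ∷ ys) s<max with ℕP.≤-total y (foldr ℕ._⊔_ 0 ys)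
... | inj₁ y≤rest =
  let (z , z∈ys , s<z) = ⊔-witness ys (subst (suc _ ℕ.≤_) (ℕP.m≤n⇒m⊔n≡n y≤rest) s<max)
  in z , there z∈ys , s<z
... | inj₂ rest≤y = y , here refl , subst (suc _ ℕ.≤_) (ℕP.m≥n⇒m⊔n≡m rest≤y) s<max

and-map⇒ : ∀ {A : Set} (g : A → Bool) xs {t} → T (and (map g xs)) → t ∈ xs → T (g t)
and-map⇒ g (x ∷ xs) holds (here refl)  = proj₁ (Equivalence.to T-∧ holds)
and-map⇒ g (x ∷ xs) holds (there t∈xs) = and-map⇒ g xs (proj₂ (Equivalence.to T-∧ holds)) t∈xs

gapsAt : ∀ {N} → Vec (Fin N) N → ℕ → List ℕ
gapsAt {N} x i = map (λ ℓ → if emptyRun x i ℓ then ℓ else 0) (upTo N)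

-- emptyRun x i ℓ says that the ℓ+1 bins i, …, i+ℓ exist and are empty.
emptyRun⇒WindowEmpty : ∀ {N} (x : Vec (Fin N) N) i ℓ → T (emptyRun x i ℓ) →
                       (i ℕ.+ ℓ ℕ.< N) × WindowEmpty x i (suc ℓ)
emptyRun⇒WindowEmpty {N} x i ℓ run with (i ℕ.+ ℓ) ℕ.<ᵇ N in fits
... | true = ℕP.<ᵇ⇒< (i ℕ.+ ℓ) N (subst T (sym fits) tt) , empty
  where
  empty : WindowEmpty x i (suc ℓ)
  empty m i≤m m<i+ℓ+1 = trans (cong (φ x) (sym (ℕP.m+[n∸m]≡n i≤m)))
    (ℕP.≡ᵇ⇒≡ _ 0 (and-map⇒ (λ t → φ x (i ℕ.+ t) ℕ.≡ᵇ 0) (upTo (suc ℓ)) run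
                   (∈-upTo⁺ (ℕP.m<n+o⇒m∸n<o m i m<i+ℓ+1))))

longGap⇒emptyRun : ∀ {N} ℓ (x : Vec (Fin N) N) → T (suc ℓ ≤ᵇ maxGap x) →
  Σ ℕ λ i → i ∈ upTo N × Σ ℕ λ ℓ₀ → suc ℓ ℕ.≤ ℓ₀ × T (emptyRun x i ℓ₀)
longGap⇒emptyRun {N} ℓ x long
  with ⊔-witness (concatMap (gapsAt x) (upTo N)) (ℕP.≤ᵇ⇒≤ (suc ℓ) (maxGap x) long)
... | y , y∈gaps , ℓ<y with find (∈-concatMap⁻ (gapsAt x) {xs = upTo N} y∈gaps)
... | i , i∈ , y∈gaps-i with ∈-map⁻ (λ ℓ → if emptyRun x i ℓ then ℓ else 0) y∈gaps-i
... | ℓ₀ , _ , y≡ with emptyRun x i ℓ₀ in run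
... | true  = i , i∈ , ℓ₀ , subst (suc ℓ ℕ.≤_) y≡ ℓ<y , subst T (sym run) tt
... | false = ⊥-elim (ℕP.n≮0 (subst (suc ℓ ℕ.≤_) y≡ ℓ<y))

longGap⇒emptyWindow : ∀ {n} ℓ (x : Vec (Fin (suc n)) (suc n)) → T (ℓ ≤ᵇ maxGap x) →
  Σ ℕ λ i → i ∈ upTo (suc n) × i ℕ.+ ℓ ℕ.≤ suc n × WindowEmpty x i ℓ
longGap⇒emptyWindow ℕ.zero x _ =
  0 , ∈-upTo⁺ (ℕ.s≤s ℕ.z≤n) , ℕ.z≤n , λ m _ m<0 → ⊥-elim (ℕP.n≮0 m<0)
longGap⇒emptyWindow (suc ℓ) x long with longGap⇒emptyRun ℓ x long
... | i , i∈ , ℓ₀ , ℓ<ℓ₀ , run with emptyRun⇒WindowEmpty x i ℓ₀ run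
... | i+ℓ₀<N , empty = i , i∈ , ℕP.<⇒≤ (ℕP.≤-<-trans (ℕP.+-monoʳ-≤ i ℓ<ℓ₀) i+ℓ₀<N) , shrink
  where
  shrink : WindowEmpty x i (suc ℓ)
  shrink m i≤m m<i+ℓ = empty m i≤m (ℕP.<-≤-trans m<i+ℓ (ℕP.+-monoʳ-≤ i (ℕP.m≤n⇒m≤1+n ℓ<ℓ₀)))

if-≤ : ∀ b {w s} → (T b → w ≤ s) → 0ℚ ≤ s → (if b then w else 0ℚ) ≤ s
if-≤ true  w≤s _   = w≤s tt
if-≤ false _   0≤s = 0≤s

sumOver-if : ∀ {A : Set} b (f : A → ℚ) xs →
             sumOver (λ x → if b then f x else 0ℚ) xs ≡ (if b then sumOver f xs else 0ℚ)
sumOver-if true  f xs = refl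
sumOver-if false f xs = sumOver-zero xs

module UnionBound {n : ℕ} (P : Dist (suc n)) {d : ℚ} (0≤d : 0ℚ ≤ d)
                  (d≤P : ∀ j v → d ≤ P j v)
                  (normalised : ∀ j → sumℚ (map (P j) (allFin (suc n))) ≡ 1ℚ) where

  private
    N : ℕ
    N = suc n

  0≤P : ∀ j v → 0ℚ ≤ P j v
  0≤P j v = QP.≤-trans 0≤d (d≤P j v)

  total-mass : ∀ j → sum (P j) ≡ 1ℚ
  total-mass j = trans (sym (sumℚ-allFin N (P j))) (normalised j)

  -- d ≤ N·d ≤ Σ_v P 0 v = 1.
  d≤1 : d ≤ 1ℚ
  d≤1 = begin
    d                  ≡⟨ sym (QP.*-identityˡ d) ⟩
    1ℚ * d             ≤⟨ QP.*-monoʳ-≤-nonNeg d {{ℚ.nonNegative 0≤d}} (1≤ℕtoℚ-suc n) ⟩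
    ℕtoℚ N * d         ≤⟨ window-mass 0≤d (P Fin.zero) (d≤P Fin.zero) (λ _ → true) 0 N ℕP.≤-refl (λ _ _ _ → tt) ⟩
    sum (P Fin.zero)   ≡⟨ total-mass Fin.zero ⟩
    1ℚ                 ∎

  outside-mass : ∀ i ℓ j → i ℕ.+ ℓ ℕ.≤ N → sum (λ v → P j v * outside i ℓ v) ≤ (1ℚ - d) ^ℚ ℓ
  outside-mass i ℓ j i+ℓ≤N = begin
    S                       ≡⟨ S≡1-R ⟩
    1ℚ - R                  ≤⟨ QP.+-monoʳ-≤ 1ℚ (QP.neg-antimono-≤ ℓd≤R) ⟩
    1ℚ - ℕtoℚ ℓ * d         ≡⟨ cong (1ℚ +_) (QP.neg-distribʳ-* (ℕtoℚ ℓ) d) ⟩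
    1ℚ + ℕtoℚ ℓ * (- d)     ≤⟨ bernoulli (0≤q-p d≤1) ℓ ⟩
    (1ℚ - d) ^ℚ ℓ           ∎
    where
    S : ℚ
    S = sum (λ v → P j v * outside i ℓ v)
    R : ℚ
    R = sum (λ v → if inWindow i ℓ (toℕ v) then P j v else 0ℚ)
    ℓd≤R : ℕtoℚ ℓ * d ≤ R
    ℓd≤R = window-mass 0≤d (P j) (d≤P j) (inWindow i ℓ) i ℓ i+ℓ≤N
      (λ k i≤k k<i+ℓ → Equivalence.from T-∧ (ℕP.<⇒<ᵇ k<i+ℓ , ℕP.≤⇒≤ᵇ i≤k))
    split : ∀ v → P j v ≡ P j v * outside i ℓ v + (if inWindow i ℓ (toℕ v) then P j v else 0ℚ)
    split v with inWindow i ℓ (toℕ v)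
    ... | true  = sym (trans (cong (_+ P j v) (QP.*-zeroʳ (P j v))) (QP.+-identityˡ (P j v)))
    ... | false = sym (trans (QP.+-identityʳ _) (QP.*-identityʳ (P j v)))
    cancel : ∀ s r → s ≡ (s + r) - r
    cancel = solve-∀ ℚ-ring
    S≡1-R : S ≡ 1ℚ - R
    S≡1-R = begin-equality
      S              ≡⟨ cancel S R ⟩
      (S + R) - R    ≡⟨ cong (_- R) (sym (∑-distrib-+ (λ v → P j v * outside i ℓ v) (λ v → if inWindow i ℓ (toℕ v) then P j v else 0ℚ))) ⟩
      sum (λ v → P j v * outside i ℓ v + (if inWindow i ℓ (toℕ v) then P j v else 0ℚ)) - R
                     ≡⟨ cong (_- R) (sym (sum-cong-≗ split)) ⟩
      sum (P j) - R  ≡⟨ cong (_- R) (total-mass j) ⟩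
      1ℚ - R         ∎

  window-empty-probability : ∀ i ℓ → i ℕ.+ ℓ ℕ.≤ N →
    sumOver (λ x → weight P x * productOver (outside i ℓ) x) (outcomes N N) ≤ ((1ℚ - d) ^ℚ ℓ) ^ℚ N
  window-empty-probability i ℓ i+ℓ≤N = begin
    sumOver (λ x → weight P x * productOver (outside i ℓ) x) (outcomes N N)
      ≡⟨ independence N P (outside i ℓ) ⟩
    product (λ j → sum (λ v → P j v * outside i ℓ v))
      ≤⟨ product-≤-^ N (λ j → sum-nonNeg (λ v → *-nonNeg (0≤P j v) (outside-nonNeg i ℓ v)))
                       (λ j → outside-mass i ℓ j i+ℓ≤N) ⟩
    ((1ℚ - d) ^ℚ ℓ) ^ℚ N ∎

  window-term : ℕ → ℕ → Vec (Fin N) N → ℚ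
  window-term ℓ i x = if i ℕ.+ ℓ ℕ.≤ᵇ N then weight P x * productOver (outside i ℓ) x else 0ℚ

  window-term-nonNeg : ∀ ℓ i x → 0ℚ ≤ window-term ℓ i x
  window-term-nonNeg ℓ i x = if-nonNeg (i ℕ.+ ℓ ℕ.≤ᵇ N)
    (*-nonNeg (weight-nonNeg P 0≤P x) (product-nonNeg x))
    where
    product-nonNeg : ∀ {k} (x : Vec (Fin N) k) → 0ℚ ≤ productOver (outside i ℓ) x
    product-nonNeg []ᵥ       = 0≤1
    product-nonNeg (v ∷ᵥ xs) = *-nonNeg (outside-nonNeg i ℓ v) (product-nonNeg xs)

  window-term-total : ∀ ℓ i → sumOver (window-term ℓ i) (outcomes N N) ≤ ((1ℚ - d) ^ℚ ℓ) ^ℚ N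
  window-term-total ℓ i =
    QP.≤-trans (QP.≤-reflexive (sumOver-if (i ℕ.+ ℓ ℕ.≤ᵇ N) _ (outcomes N N)))
               (if-≤ (i ℕ.+ ℓ ℕ.≤ᵇ N) (λ fits → window-empty-probability i ℓ (ℕP.≤ᵇ⇒≤ (i ℕ.+ ℓ) N fits))
                                     (^ℚ-nonNeg N (^ℚ-nonNeg ℓ (0≤q-p d≤1))))

  covered : ∀ ℓ x → (if ℓ ≤ᵇ maxGap x then weight P x else 0ℚ)
                      ≤ sumOver (λ i → window-term ℓ i x) (upTo N)
  covered ℓ x = if-≤ (ℓ ≤ᵇ maxGap x) from-window (sumOver-nonNeg (upTo N) (λ i → window-term-nonNeg ℓ i x))
    where
    from-window : T (ℓ ≤ᵇ maxGap x) → weight P x ≤ sumOver (λ i → window-term ℓ i x) (upTo N)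
    from-window long with longGap⇒emptyWindow ℓ x long
    ... | i , i∈ , i+ℓ≤N , empty =
      QP.≤-trans (QP.≤-reflexive (sym term≡weight))
                 (sumOver-member (upTo N) (λ i → window-term-nonNeg ℓ i x) i∈)
      where
      term≡weight : window-term ℓ i x ≡ weight P x
      term≡weight rewrite Equivalence.to T-≡ (ℕP.≤⇒≤ᵇ i+ℓ≤N) | emptyWindow⇒outside i ℓ x empty = QP.*-identityʳ (weight P x)

  Pr-nonNeg : ∀ E → 0ℚ ≤ Pr P E
  Pr-nonNeg E = sumOver-nonNeg (outcomes N N) (λ x → if-nonNeg (E x) (weight-nonNeg P 0≤P x))

  gap-tail-bound : ∀ ℓ → Pr P (λ x → ℓ ≤ᵇ maxGap x) ≤ ℕtoℚ N * ((1ℚ - d) ^ℚ ℓ) ^ℚ N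
  gap-tail-bound ℓ = begin
    Pr P (λ x → ℓ ≤ᵇ maxGap x)
      ≤⟨ sumOver-mono (outcomes N N) (covered ℓ) ⟩
    sumOver (λ x → sumOver (λ i → window-term ℓ i x) (upTo N)) (outcomes N N)
      ≡⟨ sumOver-swap (window-term ℓ) (outcomes N N) (upTo N) ⟩
    sumOver (λ i → sumOver (window-term ℓ i) (outcomes N N)) (upTo N)
      ≤⟨ sumOver-≤-length (upTo N) (window-term-total ℓ) ⟩
    ℕtoℚ (length (upTo N)) * ((1ℚ - d) ^ℚ ℓ) ^ℚ N
      ≡⟨ cong (λ m → ℕtoℚ m * ((1ℚ - d) ^ℚ ℓ) ^ℚ N) (ListP.length-upTo N) ⟩
    ℕtoℚ N * ((1ℚ - d) ^ℚ ℓ) ^ℚ N ∎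

trade-power-for-decay : ∀ N D ℓ {p y} → 0ℚ ≤ p → 0ℚ ≤ y →
  p ≤ ℕtoℚ N * (y ^ℚ ℓ) ^ℚ N → (y ^ℚ (N ℕ.* D)) * ℕtoℚ 2 ≤ 1ℚ →
  (p ^ℚ D) * ℕtoℚ (2 ^ ℓ) ≤ ℕtoℚ (N ^ D)
trade-power-for-decay N D ℓ {p} {y} 0≤p 0≤y p≤bound halved = begin
  (p ^ℚ D) * ℕtoℚ (2 ^ ℓ)
    ≤⟨ QP.*-monoʳ-≤-nonNeg (ℕtoℚ (2 ^ ℓ)) {{ℚ.nonNegative (ℕtoℚ-nonNeg (2 ^ ℓ))}} (^ℚ-mono-≤ D 0≤p p≤bound) ⟩
  ((ℕtoℚ N * (y ^ℚ ℓ) ^ℚ N) ^ℚ D) * ℕtoℚ (2 ^ ℓ)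
    ≡⟨ cong₂ _*_ (^ℚ-distrib-* (ℕtoℚ N) ((y ^ℚ ℓ) ^ℚ N) D) (ℕtoℚ-^ 2 ℓ) ⟩
  (ℕtoℚ N ^ℚ D * ((y ^ℚ ℓ) ^ℚ N) ^ℚ D) * ℕtoℚ 2 ^ℚ ℓ
    ≡⟨ cong (λ t → (ℕtoℚ N ^ℚ D * t) * ℕtoℚ 2 ^ℚ ℓ) regroup-exponents ⟩
  (ℕtoℚ N ^ℚ D * z ^ℚ ℓ) * ℕtoℚ 2 ^ℚ ℓ
    ≡⟨ QP.*-assoc (ℕtoℚ N ^ℚ D) (z ^ℚ ℓ) (ℕtoℚ 2 ^ℚ ℓ) ⟩
  ℕtoℚ N ^ℚ D * (z ^ℚ ℓ * ℕtoℚ 2 ^ℚ ℓ)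
    ≡⟨ cong (ℕtoℚ N ^ℚ D *_) (sym (^ℚ-distrib-* z (ℕtoℚ 2) ℓ)) ⟩
  ℕtoℚ N ^ℚ D * (z * ℕtoℚ 2) ^ℚ ℓ
    ≤⟨ *-monoˡ-≤ (ℕtoℚ N ^ℚ D) (^ℚ-nonNeg D (ℕtoℚ-nonNeg N))
                 (^ℚ-≤1 ℓ (*-nonNeg (^ℚ-nonNeg (N ℕ.* D) 0≤y) (ℕtoℚ-nonNeg 2)) halved) ⟩
  ℕtoℚ N ^ℚ D * 1ℚ
    ≡⟨ trans (QP.*-identityʳ _) (sym (ℕtoℚ-^ N D)) ⟩
  ℕtoℚ (N ^ D) ∎
  where
  z : ℚ
  z = y ^ℚ (N ℕ.* D)
  regroup-exponents : ((y ^ℚ ℓ) ^ℚ N) ^ℚ D ≡ z ^ℚ ℓ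
  regroup-exponents = begin-equality
    ((y ^ℚ ℓ) ^ℚ N) ^ℚ D     ≡⟨ cong (_^ℚ D) (^ℚ-assoc y ℓ N) ⟩
    (y ^ℚ (ℓ ℕ.* N)) ^ℚ D    ≡⟨ ^ℚ-assoc y (ℓ ℕ.* N) D ⟩
    y ^ℚ (ℓ ℕ.* N ℕ.* D)     ≡⟨ cong (y ^ℚ_) (trans (ℕP.*-assoc ℓ N D) (ℕP.*-comm ℓ (N ℕ.* D))) ⟩
    y ^ℚ (N ℕ.* D ℕ.* ℓ)     ≡⟨ sym (^ℚ-assoc y (N ℕ.* D) ℓ) ⟩
    z ^ℚ ℓ                   ∎

-- Choice of parameters.  The per-bin lower bound is d = c₁·(1/N), and the
-- exponent is the denominator D of c₁.

ℕtoℚ-suc-positive : ∀ n → ℚ.Positive (ℕtoℚ (suc n))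
ℕtoℚ-suc-positive n = QP.normalize-pos (suc n) 1

ℕtoℚ-suc-nonZero : ∀ n → ℚ.NonZero (ℕtoℚ (suc n))
ℕtoℚ-suc-nonZero n = QP.pos⇒nonZero (ℕtoℚ (suc n)) {{ℕtoℚ-suc-positive n}}

reciprocal : ℕ → ℚ
reciprocal n = (1/ ℕtoℚ (suc n)) {{ℕtoℚ-suc-nonZero n}}

reciprocal-inverse : ∀ n → ℕtoℚ (suc n) * reciprocal n ≡ 1ℚ
reciprocal-inverse n = QP.*-inverseʳ (ℕtoℚ (suc n)) {{ℕtoℚ-suc-nonZero n}}

reciprocal-nonNeg : ∀ n → 0ℚ ≤ reciprocal n
reciprocal-nonNeg n = QP.<⇒≤ (QP.positive⁻¹ (reciprocal n)
  {{QP.1/pos⇒pos (ℕtoℚ (suc n)) {{ℕtoℚ-suc-positive n}}}})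

denominator-*-cancel : ∀ a e .(cop : Coprime (suc a) (suc e)) →
                       ℕtoℚ (suc e) * mkℚ (ℤ.+ suc a) e cop ≡ ℕtoℚ (suc a)
denominator-*-cancel a e cop rewrite ℕtoℚ-normal (suc e) | ℕtoℚ-normal (suc a) =
  QP.toℚᵘ-injective (ℚᵘP.≃-trans (QP.toℚᵘ-homo-* D c) (ℚᵘ.*≡* cross-multiplied))
  where
  D : ℚ
  D = mkℚ (ℤ.+ suc e) 0 (coprime-sym (1-coprimeTo (suc e)))
  c : ℚ
  c = mkℚ (ℤ.+ suc a) e cop
  cross-multiplied : (ℤ.+ suc e ℤ.* ℤ.+ suc a) ℤ.* ℤ.+ 1 ≡ ℤ.+ suc a ℤ.* ℤ.+ (1 ℕ.* suc e)
  cross-multiplied = trans (ℤP.*-identityʳ _) (trans (ℤP.*-comm (ℤ.+ suc e) (ℤ.+ suc a))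
    (cong (λ k → ℤ.+ suc a ℤ.* ℤ.+ k) (sym (ℕP.*-identityˡ (suc e)))))

1≤denominator*c : ∀ c → 0ℚ < c → 1ℚ ≤ ℕtoℚ (suc (ℚ.ℚ.denominator-1 c)) * c
1≤denominator*c (mkℚ (ℤ.+ 0) e _) (*<* (ℤ.+<+ ()))
1≤denominator*c (mkℚ ℤ.-[1+ a ] e _) (*<* ())
1≤denominator*c (mkℚ ℤ.+[1+ a ] e cop) _ =
  QP.≤-trans (1≤ℕtoℚ-suc a) (QP.≤-reflexive (sym (denominator-*-cancel a e cop)))

divide-bound : ∀ n {c p} → c ≤ ℕtoℚ (suc n) * p → c * reciprocal n ≤ p
divide-bound n {c} {p} c≤Np = begin
  c * reciprocal n                     ≤⟨ QP.*-monoʳ-≤-nonNeg (reciprocal n) {{ℚ.nonNegative (reciprocal-nonNeg n)}} c≤Np ⟩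
  (ℕtoℚ (suc n) * p) * reciprocal n    ≡⟨ swap (ℕtoℚ (suc n)) p (reciprocal n) ⟩
  p * (ℕtoℚ (suc n) * reciprocal n)    ≡⟨ cong (p *_) (reciprocal-inverse n) ⟩
  p * 1ℚ                               ≡⟨ QP.*-identityʳ p ⟩
  p                                    ∎
  where
  swap : ∀ a b r → (a * b) * r ≡ b * (a * r)
  swap = solve-∀ ℚ-ring

scale-by-N : ∀ n D c → ℕtoℚ (suc n ℕ.* D) * (c * reciprocal n) ≡ ℕtoℚ D * c
scale-by-N n D c = begin-equality
  ℕtoℚ (suc n ℕ.* D) * (c * reciprocal n)            ≡⟨ cong (_* (c * reciprocal n)) (ℕtoℚ-* (suc n) D) ⟩
  (ℕtoℚ (suc n) * ℕtoℚ D) * (c * reciprocal n)       ≡⟨ regroup (ℕtoℚ (suc n)) (ℕtoℚ D) c (reciprocal n) ⟩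
  (ℕtoℚ (suc n) * reciprocal n) * (ℕtoℚ D * c)       ≡⟨ cong (_* (ℕtoℚ D * c)) (reciprocal-inverse n) ⟩
  1ℚ * (ℕtoℚ D * c)                                  ≡⟨ QP.*-identityˡ (ℕtoℚ D * c) ⟩
  ℕtoℚ D * c                                         ∎
  where
  regroup : ∀ a b c r → (a * b) * (c * r) ≡ (a * r) * (b * c)
  regroup = solve-∀ ℚ-ring

-- The theorem, with q + 1 = D the denominator of c₁ and d = c₁/N.
lemma1 : (c₁ : ℚ) → 0ℚ < c₁ →
    Σ ℕ λ q →
      ∀ (n : ℕ) (P : Dist (suc n)) →
        (∀ j i → c₁ ≤ ℕtoℚ (suc n) * P j i) →
        (∀ j → sumℚ (map (P j) (allFin (suc n))) ≡ 1ℚ) →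
        ∀ (ℓ : ℕ) →
          (Pr P (λ x → ℓ ≤ᵇ maxGap x) ^ℚ suc q) * ℕtoℚ (2 ^ ℓ)
            ≤ ℕtoℚ (suc n ^ suc q)
lemma1 c₁ 0<c₁ = q , tail-bound
  where
  q : ℕ
  q = ℚ.ℚ.denominator-1 c₁
  tail-bound : ∀ n (P : Dist (suc n)) → (∀ j i → c₁ ≤ ℕtoℚ (suc n) * P j i) →
    (∀ j → sumℚ (map (P j) (allFin (suc n))) ≡ 1ℚ) → ∀ ℓ →
    (Pr P (λ x → ℓ ≤ᵇ maxGap x) ^ℚ suc q) * ℕtoℚ (2 ^ ℓ) ≤ ℕtoℚ (suc n ^ suc q)
  tail-bound n P c₁≤NP normalised ℓ =
    trade-power-for-decay (suc n) (suc q) ℓ (Pr-nonNeg _) (0≤q-p d≤1) (gap-tail-bound ℓ)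
      (halving 0≤d d≤1 (suc n ℕ.* suc q) 1≤Kd)
    where
    d : ℚ
    d = c₁ * reciprocal n
    0≤d : 0ℚ ≤ d
    0≤d = *-nonNeg (QP.<⇒≤ 0<c₁) (reciprocal-nonNeg n)
    open UnionBound P 0≤d (λ j v → divide-bound n (c₁≤NP j v)) normalised
    1≤Kd : 1ℚ ≤ ℕtoℚ (suc n ℕ.* suc q) * d
    1≤Kd = QP.≤-trans (1≤denominator*c c₁ 0<c₁) (QP.≤-reflexive (sym (scale-by-N n (suc q) c₁)))
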